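{- Let $n,k\ge 0$ and $c\ge1$ be integers and let $S$ be a $(\leq k)$-subdivision of the complete graph $K_n$. If $S$ has an anagram-free colouring with $c$ colours, then \[k\;\ge\;\left(c!\left(\frac{n}{c}-1\right)\right)^{1/c}-c.\]
   Context: An anagram is a word of the form $WP$ where $W$ is a non-empty word and $P$ is a permutation of $W$. A vertex colouring of a graph is anagram-free if the sequence of colours along every path of the graph is not an anagram. A subdivision of $G$ is obtained by replacing each edge $uv$ by a path with endpoints $u,v$; internal vertices are division vertices. A $(\le k)$-subdivision is a subdivision in which every edge receives at most $k$ division vertices. -}

module Defs where

open import Data.Nat using (ℕ; zero; suc; _≤_)
open import Data.Fin using (Fin; _<_; toℕ)
open import Data.List using (List; []; _∷_; _++_; map)
open import Data.List.Relation.Unary.Linked using (Linked)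
open import Data.List.Relation.Unary.Unique.Propositional using (Unique)
open import Data.List.Relation.Binary.Permutation.Propositional using (_↭_)
open import Data.Product using (Σ; ∃; _×_; _,_)
open import Data.Sum using (_⊎_)
open import Relation.Nullary using (¬_)
open import Relation.Binary.PropositionalEquality using (_≡_; _≢_)

Anagram : {A : Set} → List A → Set
Anagram {A} w = Σ (List A) λ W → Σ (List A) λ P →
  (W ≢ []) × (w ≡ W ++ P) × (P ↭ W)

record Path {V : Set} (Adj : V → V → Set) : Set where
  constructor path
  field
    verts    : List V
    nonempty : verts ≢ []
    distinct : Unique verts
    linked   : Linked Adj verts

AnagramFree : {V C : Set} (Adj : V → V → Set) (col : V → C) → Set
AnagramFree Adj col = (p : Path Adj) → ¬ Anagram (map col (Path.verts p))

-- Subdivision of K_n: for each pair i < j of branch vertices, the edge ij is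
-- replaced by a path with d i j division vertices (values of d at i ≥ j unused).
data SubV (n : ℕ) (d : Fin n → Fin n → ℕ) : Set where
  branch : Fin n → SubV n d
  divv   : (i j : Fin n) → i < j → Fin (d i j) → SubV n d

data SubE (n : ℕ) (d : Fin n → Fin n → ℕ) : SubV n d → SubV n d → Set where
  direct : ∀ i j (lt : i < j) → d i j ≡ 0 → SubE n d (branch i) (branch j)
  first  : ∀ i j (lt : i < j) (t : Fin (d i j)) →
           toℕ t ≡ 0 → SubE n d (branch i) (divv i j lt t)
  step   : ∀ i j (lt : i < j) (s t : Fin (d i j)) →
           suc (toℕ s) ≡ toℕ t → SubE n d (divv i j lt s) (divv i j lt t)
  final  : ∀ i j (lt : i < j) (t : Fin (d i j)) →
           suc (toℕ t) ≡ d i j → SubE n d (divv i j lt t) (branch j)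

SubAdj : (n : ℕ) (d : Fin n → Fin n → ℕ) → SubV n d → SubV n d → Set
SubAdj n d u v = SubE n d u v ⊎ SubE n d v u

module Submission where

-- By pigeonhole some colour a is carried by at least n / c branch
-- vertices; let u be the least of them.  For every other branch vertex v
-- of colour a, the division vertices of the edge uv carry a word of
-- length at most k, and we record its Parikh vector (the number of
-- occurrences of each colour), a vector in ℕ^c with coordinate sum ≤ k.
-- If two such vertices v ≠ w had the same Parikh vector, the path
--   v, (edge vu inward), u, (edge uw outward, stopping before w)
-- would be coloured W P with P a permutation of W, an anagram.  Hence
-- these Parikh vectors are distinct and there are at most (k+c)^c / c!
-- of them, so n ≤ c (1 + (k+c)^c / c!), which is the theorem.

open import Defs
open import Data.Nat using (ℕ; _+_; _*_; _^_; _≤_; _!)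
open import Data.Fin using (Fin; _<_)

import Data.Nat as ℕ
open import Data.Nat using (zero; suc; z≤n; s≤s; s≤s⁻¹)
open import Data.Nat.Properties hiding (_≟_; _<?_)
open import Data.Nat.Tactic.RingSolver using (solve-∀)
open import Data.Fin using (zero; suc; toℕ; fromℕ<; _≟_; _<?_)
import Data.Fin.Properties as Finₚ
open import Data.Vec as Vec using (Vec; []; _∷_; lookup)
open import Data.List
  using (List; []; _∷_; _++_; _∷ʳ_; length; map; replicate; filter;
         reverse; applyUpTo; applyDownFrom; allFin)
open import Data.List.Properties
  using (length-++; length-map; length-applyUpTo; length-tabulate; map-++;
         reverse-applyUpTo; applyDownFrom-∷ʳ)
open import Data.List.Membership.Propositional using (_∈_)
open import Data.List.Membership.Propositional.Properties
  using (∈-map⁺; ∈-map⁻; ∈-++⁺ˡ; ∈-++⁺ʳ; ∈-++⁻; ∈-∃++)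
open import Data.List.Relation.Unary.Any using (here; there)
open import Data.List.Relation.Unary.All as All using (All; []; _∷_)
import Data.List.Relation.Unary.All.Properties as Allₚ
open import Data.List.Relation.Unary.AllPairs using (AllPairs; []; _∷_)
import Data.List.Relation.Unary.AllPairs.Properties as AllPairsₚ
open import Data.List.Relation.Unary.Linked using (Linked; [-]; _∷_)
import Data.List.Relation.Unary.Linked.Properties as Linkedₚ
open import Data.List.Relation.Unary.Unique.Propositional using (Unique)
import Data.List.Relation.Unary.Unique.Propositional.Properties as Uniqueₚ
open import Data.List.Relation.Binary.Disjoint.Propositional using (Disjoint)
open import Data.List.Relation.Binary.Permutation.Propositional
  using (_↭_; prep; ↭-refl; ↭-trans; ↭-sym; module PermutationReasoning)
open import Data.List.Relation.Binary.Permutation.Propositional.Properties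
  using (shift; ++⁺ˡ; map⁺; ↭-reverse)
open import Data.Product using (∃; _×_; _,_; proj₁; proj₂)
open import Data.Sum using (_⊎_; inj₁; inj₂)
open import Function using (_∘_; id)
open import Relation.Nullary using (yes; no; contradiction)
open import Relation.Binary.PropositionalEquality
  using (_≡_; _≢_; refl; sym; trans; cong; cong₂; subst; subst₂; module ≡-Reasoning)

-- Parikh vectors

zeros : ∀ {c} → List (Fin (suc c)) → ℕ
zeros []           = 0
zeros (zero  ∷ xs) = suc (zeros xs)
zeros (suc _ ∷ xs) = zeros xs

others : ∀ {c} → List (Fin (suc c)) → List (Fin c)
others []           = []
others (zero  ∷ xs) = others xs
others (suc x ∷ xs) = x ∷ others xs

parikh : ∀ {c} → List (Fin c) → Vec ℕ c
parikh {zero}  _  = []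
parikh {suc c} xs = zeros xs ∷ parikh (others xs)

length-zeros-others : ∀ {c} (xs : List (Fin (suc c))) →
                      length xs ≡ zeros xs + length (others xs)
length-zeros-others []           = refl
length-zeros-others (zero  ∷ xs) = cong suc (length-zeros-others xs)
length-zeros-others (suc _ ∷ xs) =
  trans (cong suc (length-zeros-others xs)) (sym (+-suc (zeros xs) _))

sum-parikh : ∀ {c} (xs : List (Fin c)) → Vec.sum (parikh xs) ≡ length xs
sum-parikh {zero}  []       = refl
sum-parikh {zero}  (() ∷ _)
sum-parikh {suc c} xs =
  trans (cong (zeros xs +_) (sum-parikh (others xs))) (sym (length-zeros-others xs))

zeros-first : ∀ {c} (xs : List (Fin (suc c))) →
              xs ↭ replicate (zeros xs) zero ++ map suc (others xs)
zeros-first []           = ↭-refl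
zeros-first (zero  ∷ xs) = prep zero (zeros-first xs)
zeros-first (suc x ∷ xs) = ↭-trans (prep (suc x) (zeros-first xs))
  (↭-sym (shift (suc x) (replicate (zeros xs) zero) (map suc (others xs))))

parikh-↭ : ∀ {c} (xs ys : List (Fin c)) → parikh xs ≡ parikh ys → xs ↭ ys
parikh-↭ {zero}  []       []       _ = ↭-refl
parikh-↭ {zero}  []       (() ∷ _) _
parikh-↭ {zero}  (() ∷ _) _        _
parikh-↭ {suc c} xs ys eq = begin
  xs                                                ↭⟨ zeros-first xs ⟩
  replicate (zeros xs) zero ++ map suc (others xs)  ≡⟨ cong (λ z → replicate z zero ++ map suc (others xs)) (cong Vec.head eq) ⟩
  replicate (zeros ys) zero ++ map suc (others xs)  ↭⟨ ++⁺ˡ (replicate (zeros ys) zero) (map⁺ suc (parikh-↭ (others xs) (others ys) (cong Vec.tail eq))) ⟩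
  replicate (zeros ys) zero ++ map suc (others ys)  ↭⟨ ↭-sym (zeros-first ys) ⟩
  ys                                                ∎
  where open PermutationReasoning

parikh-∷-same : ∀ {c} (a : Fin c) xs → lookup (parikh (a ∷ xs)) a ≡ suc (lookup (parikh xs) a)
parikh-∷-same zero    xs = refl
parikh-∷-same (suc a) xs = parikh-∷-same a (others xs)

parikh-∷-other : ∀ {c} (a x : Fin c) xs → x ≢ a → lookup (parikh (x ∷ xs)) a ≡ lookup (parikh xs) a
parikh-∷-other zero    zero    xs x≢a = contradiction refl x≢a
parikh-∷-other zero    (suc x) xs x≢a = refl
parikh-∷-other (suc a) zero    xs x≢a = refl
parikh-∷-other (suc a) (suc x) xs x≢a = parikh-∷-other a x (others xs) (x≢a ∘ cong suc)

length-filter-parikh : ∀ {A : Set} {c} (g : A → Fin c) (a : Fin c) (ys : List A) →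
                       length (filter (λ y → g y ≟ a) ys) ≡ lookup (parikh (map g ys)) a
length-filter-parikh g a []       = sym (lookup-parikh-[] a)
  where
  lookup-parikh-[] : ∀ {c} (a : Fin c) → lookup (parikh []) a ≡ 0
  lookup-parikh-[] zero    = refl
  lookup-parikh-[] (suc a) = lookup-parikh-[] a
length-filter-parikh g a (y ∷ ys) with g y ≟ a
... | yes refl = trans (cong suc (length-filter-parikh g a ys)) (sym (parikh-∷-same a (map g ys)))
... | no gy≢a  = trans (length-filter-parikh g a ys) (sym (parikh-∷-other a (g y) (map g ys) gy≢a))

pigeonhole : ∀ c (v : Vec ℕ (suc c)) → ∃ λ a → Vec.sum v ≤ suc c * lookup v a
pigeonhole zero    (x ∷ []) = zero , ≤-refl
pigeonhole (suc c) (x ∷ v) with pigeonhole c v | ≤-total (lookup v (proj₁ (pigeonhole c v))) x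
... | a , sum≤ | inj₁ y≤x = zero , +-monoʳ-≤ x (≤-trans sum≤ (*-monoʳ-≤ (suc c) y≤x))
... | a , sum≤ | inj₂ x≤y = suc a , +-mono-≤ x≤y sum≤

incHead : ∀ {c} → Vec ℕ (suc c) → Vec ℕ (suc c)
incHead (x ∷ v) = suc x ∷ v

bounded : (c k : ℕ) → List (Vec ℕ c)
bounded zero    k       = [] ∷ []
bounded (suc c) zero    = map (0 ∷_) (bounded c zero)
bounded (suc c) (suc k) = map (0 ∷_) (bounded c (suc k)) ++ map incHead (bounded (suc c) k)

bounded-complete : ∀ c k (v : Vec ℕ c) → Vec.sum v ≤ k → v ∈ bounded c k
bounded-complete zero    k       []          _  = here refl
bounded-complete (suc c) zero    (zero ∷ v)  le = ∈-map⁺ (0 ∷_) (bounded-complete c zero v le)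
bounded-complete (suc c) (suc k) (zero ∷ v)  le = ∈-++⁺ˡ (∈-map⁺ (0 ∷_) (bounded-complete c (suc k) v le))
bounded-complete (suc c) (suc k) (suc x ∷ v) (s≤s le) =
  ∈-++⁺ʳ (map (0 ∷_) (bounded c (suc k))) (∈-map⁺ incHead (bounded-complete (suc c) k (x ∷ v) le))

bernoulli : ∀ m c → m ^ suc c + suc c * m ^ c ≤ suc m ^ suc c
bernoulli m zero    = ≤-reflexive (identity m)
  where
  identity : ∀ m → m * 1 + 1 * 1 ≡ suc m * 1
  identity = solve-∀
bernoulli m (suc c) = begin
  m * (m * m ^ c) + suc (suc c) * (m * m ^ c)                ≤⟨ m≤m+n _ (suc c * m ^ c) ⟩
  m * (m * m ^ c) + suc (suc c) * (m * m ^ c) + suc c * m ^ c ≡⟨ identity m c (m ^ c) ⟩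
  suc m * (m ^ suc c + suc c * m ^ c)                         ≤⟨ *-monoʳ-≤ (suc m) (bernoulli m c) ⟩
  suc m * suc m ^ suc c                                       ∎
  where
  open ≤-Reasoning
  identity : ∀ m c X → m * (m * X) + suc (suc c) * (m * X) + suc c * X ≡ suc m * (m * X + suc c * X)
  identity = solve-∀

bounded-count : ∀ c k → c ! * length (bounded c k) ≤ (k + c) ^ c
bounded-count zero    k    = ≤-refl
bounded-count (suc c) zero = begin
  suc c * c ! * length (map (0 ∷_) (bounded c zero)) ≡⟨ cong (suc c * c ! *_) (length-map (0 ∷_) (bounded c zero)) ⟩
  suc c * c ! * length (bounded c zero)              ≡⟨ *-assoc (suc c) (c !) _ ⟩
  suc c * (c ! * length (bounded c zero))            ≤⟨ *-monoʳ-≤ (suc c) (bounded-count c zero) ⟩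
  suc c * c ^ c                                      ≤⟨ *-monoʳ-≤ (suc c) (^-monoˡ-≤ c (n≤1+n c)) ⟩
  suc c * suc c ^ c                                  ∎
  where open ≤-Reasoning
bounded-count (suc c) (suc k) = begin
  suc c * c ! * length (bounded (suc c) (suc k)) ≡⟨ cong (suc c * c ! *_) length-split ⟩
  suc c * c ! * (A + B)                          ≡⟨ distribute (suc c) (c !) A B ⟩
  suc c * (c ! * A) + suc c * c ! * B            ≤⟨ +-mono-≤ (*-monoʳ-≤ (suc c) (bounded-count c (suc k))) (bounded-count (suc c) k) ⟩
  suc c * (suc k + c) ^ c + (k + suc c) ^ suc c  ≡⟨ cong (λ z → suc c * (suc k + c) ^ c + z ^ suc c) (+-suc k c) ⟩
  suc c * m ^ c + m ^ suc c                      ≡⟨ +-comm (suc c * m ^ c) _ ⟩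
  m ^ suc c + suc c * m ^ c                      ≤⟨ bernoulli m c ⟩
  suc m ^ suc c                                  ≡⟨ cong (_^ suc c) (sym (+-suc (suc k) c)) ⟩
  (suc k + suc c) ^ suc c                        ∎
  where
  open ≤-Reasoning
  A = length (bounded c (suc k))
  B = length (bounded (suc c) k)
  m = suc k + c
  length-split : length (bounded (suc c) (suc k)) ≡ A + B
  length-split = trans (length-++ (map (0 ∷_) (bounded c (suc k))))
    (cong₂ _+_ (length-map (0 ∷_) (bounded c (suc k))) (length-map incHead (bounded (suc c) k)))
  distribute : ∀ s f A B → s * f * (A + B) ≡ s * (f * A) + s * f * B
  distribute = solve-∀

unique-⊆-length : ∀ {A : Set} (xs ys : List A) → Unique xs → (∀ {x} → x ∈ xs → x ∈ ys) →
                  length xs ≤ length ys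
unique-⊆-length []       ys _            _   = z≤n
unique-⊆-length (x ∷ xs) ys (x∉xs ∷ uxs) xs⊆ys with ∈-∃++ (xs⊆ys (here refl))
... | us , vs , refl = begin
  suc (length xs)             ≤⟨ s≤s (unique-⊆-length xs (us ++ vs) uxs xs⊆us++vs) ⟩
  suc (length (us ++ vs))     ≡⟨ cong suc (length-++ us) ⟩
  suc (length us + length vs) ≡⟨ sym (+-suc (length us) (length vs)) ⟩
  length us + length (x ∷ vs) ≡⟨ sym (length-++ us) ⟩
  length (us ++ x ∷ vs)       ∎
  where
  open ≤-Reasoning
  xs⊆us++vs : ∀ {z} → z ∈ xs → z ∈ us ++ vs
  xs⊆us++vs {z} z∈xs with ∈-++⁻ us (xs⊆ys (there z∈xs))
  ... | inj₁ z∈us        = ∈-++⁺ˡ z∈us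
  ... | inj₂ (here refl) = contradiction refl (All.lookup x∉xs z∈xs)
  ... | inj₂ (there z∈vs) = ∈-++⁺ʳ us z∈vs

linked-join : ∀ {A : Set} {R : A → A → Set} xs {y ys} →
              Linked R (xs ∷ʳ y) → Linked R (y ∷ ys) → Linked R (xs ++ y ∷ ys)
linked-join []            _          ry = ry
linked-join (x ∷ [])      (r ∷ [-])  ry = r ∷ ry
linked-join (x ∷ x′ ∷ xs) (r ∷ rxs)  ry = r ∷ linked-join (x′ ∷ xs) rxs ry

all-applyDownFrom : ∀ {A : Set} {P : A → Set} (f : ℕ → A) → (∀ a → P (f a)) →
                    ∀ m → All P (applyDownFrom f m)
all-applyDownFrom f Pf zero    = []
all-applyDownFrom f Pf (suc m) = Pf m ∷ all-applyDownFrom f Pf m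

-- Walking along a subdivided edge

module Subdivision {n : ℕ} (d : Fin n → Fin n → ℕ) where

  -- walk i j lt a is the a-th vertex on the path replacing the edge ij:
  -- branch i for a = 0, the division vertices for 1 ≤ a ≤ d i j, and
  -- branch j from a = d i j + 1 on.
  walk : (i j : Fin n) → i < j → ℕ → SubV n d
  walk i j lt zero = branch i
  walk i j lt (suc a) with a ℕ.<? d i j
  ... | yes a<m = divv i j lt (fromℕ< a<m)
  ... | no  _   = branch j

  walk-suc : ∀ i j (lt : i < j) a →
             (∃ λ (a<m : a ℕ.< d i j) → walk i j lt (suc a) ≡ divv i j lt (fromℕ< a<m))
             ⊎ (d i j ≤ a × walk i j lt (suc a) ≡ branch j)
  walk-suc i j lt a with a ℕ.<? d i j
  ... | yes a<m = inj₁ (a<m , refl)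
  ... | no  a≮m = inj₂ (≮⇒≥ a≮m , refl)

  walk-end : ∀ i j (lt : i < j) → walk i j lt (suc (d i j)) ≡ branch j
  walk-end i j lt with walk-suc i j lt (d i j)
  ... | inj₁ (m<m , _) = contradiction m<m (n≮n (d i j))
  ... | inj₂ (_ , e)   = e

  walk-step : ∀ i j (lt : i < j) a → a ≤ d i j → SubE n d (walk i j lt a) (walk i j lt (suc a))
  walk-step i j lt zero _ with walk-suc i j lt zero
  ... | inj₁ (0<m , e) rewrite e = first i j lt (fromℕ< 0<m) (Finₚ.toℕ-fromℕ< 0<m)
  ... | inj₂ (m≤0 , e) rewrite e = direct i j lt (n≤0⇒n≡0 m≤0)
  walk-step i j lt (suc a) a+1≤m with walk-suc i j lt a | walk-suc i j lt (suc a)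
  ... | inj₂ (m≤a , _) | _ = contradiction a+1≤m (≤⇒≯ m≤a)
  ... | inj₁ (a<m′ , e) | inj₁ (a+1<m , e′) rewrite e | e′ =
    step i j lt _ _ (trans (cong suc (Finₚ.toℕ-fromℕ< a<m′)) (sym (Finₚ.toℕ-fromℕ< a+1<m)))
  ... | inj₁ (a<m′ , e) | inj₂ (m≤a+1 , e′) rewrite e | e′ =
    final i j lt _ (trans (cong suc (Finₚ.toℕ-fromℕ< a<m′)) (≤-antisym a+1≤m m≤a+1))

  far : SubV n d → Fin n
  far (branch x)     = x
  far (divv _ j _ _) = j

  far-walk : ∀ i j (lt : i < j) a → far (walk i j lt (suc a)) ≡ j
  far-walk i j lt a with walk-suc i j lt a
  ... | inj₁ (_ , e) rewrite e = refl
  ... | inj₂ (_ , e) rewrite e = refl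

  -- position i j is a left inverse of walk i j lt on positions 0 … d i j + 1.
  position : (i j : Fin n) → SubV n d → ℕ
  position i j (branch x) with x ≟ i
  ... | yes _ = 0
  ... | no  _ = suc (d i j)
  position i j (divv _ _ _ t) = suc (toℕ t)

  position-walk : ∀ i j (lt : i < j) a → a ≤ suc (d i j) → position i j (walk i j lt a) ≡ a
  position-walk i j lt zero _ with i ≟ i
  ... | yes _  = refl
  ... | no i≢i = contradiction refl i≢i
  position-walk i j lt (suc a) a≤m with walk-suc i j lt a
  ... | inj₁ (a<m , e) rewrite e = cong suc (Finₚ.toℕ-fromℕ< a<m)
  ... | inj₂ (m≤a , e) rewrite e with j ≟ i
  ...   | yes refl = contradiction lt (Finₚ.<-irrefl refl)
  ...   | no  _    = cong suc (≤-antisym m≤a (s≤s⁻¹ a≤m))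

  walk-injective : ∀ i j (lt : i < j) {a b} → a ≤ suc (d i j) → b ≤ suc (d i j) →
                   walk i j lt a ≡ walk i j lt b → a ≡ b
  walk-injective i j lt {a} {b} a≤ b≤ e = begin
    a                               ≡⟨ sym (position-walk i j lt a a≤) ⟩
    position i j (walk i j lt a)    ≡⟨ cong (position i j) e ⟩
    position i j (walk i j lt b)    ≡⟨ position-walk i j lt b b≤ ⟩
    b                               ∎
    where open ≡-Reasoning

  interior : (i j : Fin n) → i < j → List (SubV n d)
  interior i j lt = applyUpTo (walk i j lt ∘ suc) (d i j)

  length-interior : ∀ i j (lt : i < j) → length (interior i j lt) ≡ d i j
  length-interior i j lt = length-applyUpTo (walk i j lt ∘ suc) (d i j)

  -- The "cherry" through two edges uv and uw with u < v, u < w, v ≠ w: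
  -- v, the interior of uv backwards, u, the interior of uw forwards.
  module Cherry {u v w : Fin n} (uv : u < v) (uw : u < w) (v≢w : v ≢ w) where

    inward : List (SubV n d)
    inward = applyDownFrom (walk u v uv ∘ suc) (suc (d u v))

    outward : List (SubV n d)
    outward = applyUpTo (walk u w uw) (suc (d u w))

    -- inward ends, and outward starts, at u; both are walks along edges of S.
    linked : Linked (SubAdj n d) (inward ++ outward)
    linked = linked-join inward inward-to-u outward-linked
      where
      inward-to-u : Linked (SubAdj n d) (inward ∷ʳ branch u)
      inward-to-u = subst (Linked (SubAdj n d)) (sym (applyDownFrom-∷ʳ (walk u v uv) (suc (d u v))))
        (Linkedₚ.applyDownFrom⁺₁ (walk u v uv) _
          (λ {a} a+1<m+2 → inj₂ (walk-step u v uv a (s≤s⁻¹ (s≤s⁻¹ a+1<m+2)))))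
      outward-linked : Linked (SubAdj n d) outward
      outward-linked = Linkedₚ.applyUpTo⁺₁ (walk u w uw) _
        (λ {a} a+1<m+1 → inj₁ (walk-step u w uw a (<⇒≤ (s≤s⁻¹ a+1<m+1))))

    -- Every vertex of inward lies on an edge ending at v, none of outward does.
    disjoint : Disjoint inward outward
    disjoint (x∈in , x∈out) = All.lookup outward-avoids-v x∈out (All.lookup inward-at-v x∈in)
      where
      inward-at-v : All (λ x → far x ≡ v) inward
      inward-at-v = all-applyDownFrom (walk u v uv ∘ suc) (far-walk u v uv) (suc (d u v))
      outward-avoids-v : All (λ y → far y ≢ v) outward
      outward-avoids-v = Allₚ.applyUpTo⁺₂ (walk u w uw) _ avoids
        where
        avoids : ∀ a → far (walk u w uw a) ≢ v
        avoids zero    = Finₚ.<⇒≢ uv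
        avoids (suc a) = v≢w ∘ sym ∘ trans (sym (far-walk u w uw a))

    unique : Unique (inward ++ outward)
    unique = Uniqueₚ.++⁺ unique-inward unique-outward disjoint
      where
      unique-inward : Unique inward
      unique-inward = Uniqueₚ.applyDownFrom⁺₁ (walk u v uv ∘ suc) _ λ b<a a<m e →
        <⇒≢ b<a (sym (suc-injective (walk-injective u v uv a<m (s≤s (<⇒≤ (<-≤-trans b<a (s≤s⁻¹ a<m)))) e)))
      unique-outward : Unique outward
      unique-outward = Uniqueₚ.applyUpTo⁺₁ (walk u w uw) _ λ a<b b<m e →
        <⇒≢ a<b (walk-injective u w uw (<⇒≤ (<-trans a<b b<m)) (<⇒≤ b<m) e)

    cherry : Path (SubAdj n d)
    cherry = path (inward ++ outward) (λ ()) unique linked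

    cherry-anagram : ∀ {C : Set} (col : SubV n d → C) → col (branch v) ≡ col (branch u) →
                     map col (interior u w uw) ↭ map col (interior u v uv) →
                     Anagram (map col (Path.verts cherry))
    cherry-anagram col same-colour words↭ =
      map col inward , map col outward , (λ ()) , map-++ col inward outward , outward↭inward
      where
      open PermutationReasoning
      outward↭inward : map col outward ↭ map col inward
      outward↭inward = begin
        col (branch u) ∷ map col (interior u w uw)           ↭⟨ prep _ words↭ ⟩
        col (branch u) ∷ map col (interior u v uv)           ↭⟨ prep _ (map⁺ col (↭-sym (↭-reverse (interior u v uv)))) ⟩
        col (branch u) ∷ map col (reverse (interior u v uv)) ≡⟨ cong₂ (λ x xs → x ∷ map col xs)
                                                                  (sym (trans (cong col (walk-end u v uv)) same-colour))
                                                                  (reverse-applyUpTo (walk u v uv ∘ suc) (d u v)) ⟩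
        col (walk u v uv (suc (d u v))) ∷ map col (applyDownFrom (walk u v uv ∘ suc) (d u v)) ∎

-- One colour class of branch vertices is small.

module ColourClass {n c : ℕ} (d : Fin n → Fin n → ℕ) (col : SubV n d → Fin c)
                   (anagram-free : AnagramFree (SubAdj n d) col) where

  open Subdivision d

  -- The colour word on the interior of the edge ij (empty unless i < j).
  edge-word : Fin n → Fin n → List (Fin c)
  edge-word i j with i <? j
  ... | yes lt = map col (interior i j lt)
  ... | no  _  = []

  edge-word-interior : ∀ {i j} (lt : i < j) → edge-word i j ≡ map col (interior i j lt)
  edge-word-interior {i} {j} lt with i <? j
  ... | yes lt′ rewrite Finₚ.<-irrelevant lt lt′ = refl
  ... | no  i≮j = contradiction lt i≮j

  -- Edges from u to two distinct vertices of u's colour carry colour words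
  -- with different Parikh vectors, otherwise the cherry is an anagram.
  parikh-distinct : ∀ {u v w} → u < v → u < w → v ≢ w →
                    col (branch v) ≡ col (branch u) →
                    parikh (edge-word u v) ≢ parikh (edge-word u w)
  parikh-distinct {u} {v} {w} uv uw v≢w same-colour same-parikh =
    anagram-free cherry (cherry-anagram col same-colour words↭)
    where
    open Cherry uv uw v≢w
    words↭ : map col (interior u w uw) ↭ map col (interior u v uv)
    words↭ = subst₂ _↭_ (edge-word-interior uw) (edge-word-interior uv)
               (parikh-↭ (edge-word u w) (edge-word u v) (sym same-parikh))

  key : Fin n → Fin n → Vec ℕ c
  key u j = parikh (edge-word u j)

  keys-distinct : ∀ {u} R → AllPairs _<_ R → All (λ v → u < v × col (branch v) ≡ col (branch u)) R →
                  Unique (map (key u) R)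
  keys-distinct     []      []           []              = []
  keys-distinct {u} (v ∷ R) (v<R ∷ ordR) ((uv , cv) ∷ hR) =
    Allₚ.map⁺ (All.zipWith distinct (v<R , hR)) ∷ keys-distinct R ordR hR
    where
    distinct : ∀ {w} → v < w × (u < w × col (branch w) ≡ col (branch u)) → key u v ≢ key u w
    distinct (v<w , uw , _) = parikh-distinct uv uw (Finₚ.<⇒≢ v<w) cv

  colour-class-bound : ∀ k → (∀ i j → i < j → d i j ≤ k) → ∀ {a} (K : List (Fin n)) →
                       AllPairs _<_ K → All (λ i → col (branch i) ≡ a) K →
                       length K ≤ suc (length (bounded c k))
  colour-class-bound k short []      _            _          = z≤n
  colour-class-bound k short (u ∷ R) (u<R ∷ ordR) (cu ∷ cR) = s≤s (begin
    length R               ≡⟨ sym (length-map (key u) R) ⟩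
    length (map (key u) R) ≤⟨ unique-⊆-length _ _ (keys-distinct R ordR later-same) keys-bounded ⟩
    length (bounded c k)   ∎)
    where
    open ≤-Reasoning
    later-same : All (λ v → u < v × col (branch v) ≡ col (branch u)) R
    later-same = All.zipWith (λ (uv , cv) → uv , trans cv (sym cu)) (u<R , cR)
    keys-bounded : ∀ {x} → x ∈ map (key u) R → x ∈ bounded c k
    keys-bounded x∈ with ∈-map⁻ (key u) x∈
    ... | v , v∈R , refl = bounded-complete c k (key u v) (begin
      Vec.sum (key u v)                  ≡⟨ sum-parikh (edge-word u v) ⟩
      length (edge-word u v)             ≡⟨ cong length (edge-word-interior uv) ⟩
      length (map col (interior u v uv)) ≡⟨ length-map col (interior u v uv) ⟩
      length (interior u v uv)           ≡⟨ length-interior u v uv ⟩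
      d u v                              ≤⟨ short u v uv ⟩
      k                                  ∎)
      where uv = proj₁ (All.lookup later-same v∈R)

theorem8 : (n k c : ℕ) → 1 ≤ c →
    (d : Fin n → Fin n → ℕ) → (∀ i j → i < j → d i j ≤ k) →
    (col : SubV n d → Fin c) → AnagramFree (SubAdj n d) col →
    (c !) * n ≤ c * (k + c) ^ c + (c !) * c
theorem8 n k (suc c′) _ d short col anagram-free = begin
  c ! * n                   ≤⟨ *-monoʳ-≤ (c !) (≤-trans n≤c*|K| (*-monoʳ-≤ c |K|≤1+L)) ⟩
  c ! * (c * suc L)         ≡⟨ rearrange (c !) c L ⟩
  c * (c ! * L) + c ! * c   ≤⟨ +-monoˡ-≤ (c ! * c) (*-monoʳ-≤ c (bounded-count c k)) ⟩
  c * (k + c) ^ c + c ! * c ∎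
  where
  open ≤-Reasoning
  open ColourClass d col anagram-free
  c : ℕ
  c = suc c′
  L : ℕ
  L = length (bounded c k)
  branch-colours : List (Fin c)
  branch-colours = map (col ∘ branch) (allFin n)
  -- a colour carried by at least n / c branch vertices, and its class K
  a : Fin c
  a = proj₁ (pigeonhole c′ (parikh branch-colours))
  K : List (Fin n)
  K = filter (λ i → col (branch i) ≟ a) (allFin n)
  n≤c*|K| : n ≤ c * length K
  n≤c*|K| = subst₂ (λ x y → x ≤ c * y)
    (trans (sum-parikh branch-colours) (trans (length-map _ (allFin n)) (length-tabulate id)))
    (sym (length-filter-parikh (col ∘ branch) a (allFin n)))
    (proj₂ (pigeonhole c′ (parikh branch-colours)))
  |K|≤1+L : length K ≤ suc L
  |K|≤1+L = colour-class-bound k short K (AllPairsₚ.filter⁺ _ (AllPairsₚ.tabulate⁺-< id))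
              (Allₚ.all-filter _ (allFin n))
  rearrange : ∀ f c L → f * (c * suc L) ≡ c * (f * L) + f * c
  rearrange = solve-∀
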